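{- Let $N'$ and $N''$ be single-output combinational Boolean circuits, let $F_{N'}(X',Y',z')$ and $F_{N''}(X'',Y'',z'')$ be CNF formulas specifying them, and let $\mathit{EQ}(X',X'')$, $G=\mathit{EQ}\wedge F_{N'}\wedge F_{N''}$ and $G^{\mathrm{rlx}}=F_{N'}\wedge F_{N''}$ be as in the context. Let $W=X'\cup X''\cup Y'\cup Y''$ and let $H(z',z'')$ be a formula depending only on $z',z''$ such that $$\exists W\,[\mathit{EQ}\wedge G^{\mathrm{rlx}}]\equiv H\wedge \exists W\,[G^{\mathrm{rlx}}].$$ Then the formula $G\wedge(z'\not\equiv z'')$ is satisfiable if and only if the formula $H\wedge G^{\mathrm{rlx}}\wedge(z'\not\equiv z'')$ is satisfiable.
   Context: $N'$ has input variables $X'$, internal variables $Y'$ and output variable $z'$; $N''$ has input variables $X''$, internal variables $Y''$ and output variable $z''$; the variable sets of $N'$ and $N''$ are disjoint, and $|X'|=|X''|$ with a fixed correspondence between the variables of $X'$ and $X''$. A CNF formula $F_N$ specifies a circuit $N$ if its satisfying assignments are exactly the assignments to the variables of $N$ that are consistent with the gates of $N$. $\mathit{EQ}(X',X'')$ is a formula that evaluates to 1 under assignments $\vec{x}',\vec{x}''$ to $X',X''$ iff $\vec{x}'=\vec{x}''$ (corresponding variables take equal values). $\exists W[\cdot]$ denotes existential quantification over the variables of $W$, and $\equiv$ denotes logical equivalence of formulas in their free variables. -}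

module Defs where

open import Data.Nat using (ℕ)
open import Data.Fin using (Fin; _<_)
open import Data.Bool using (Bool; true; false; not; _∧_; _∨_)
open import Data.List using (List; []; _∷_)
open import Data.Product using (_×_; Σ; ∃; ∃-syntax; _,_)
open import Relation.Binary.PropositionalEquality using (_≡_; _≢_)
open import Function using (_∘_)

data Var (n m : ℕ) : Set where
  inp : Fin n → Var n m
  int : Fin m → Var n m
  out : Var n m

Assignment : ℕ → ℕ → Set
Assignment n m = Var n m → Bool

-- Internal gate i computes an arbitrary Boolean function of the inputs
-- and of the internal gates j < i (topological order => acyclic);
-- the output gate computes a Boolean function of inputs and internal gates.

record Circuit (n m : ℕ) : Set where
  field
    gate    : (i : Fin m) → (Fin n → Bool) → ((j : Fin m) → j < i → Bool) → Bool
    outGate : (Fin n → Bool) → (Fin m → Bool) → Bool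

open Circuit public

Consistent : ∀ {n m} → Circuit n m → Assignment n m → Set
Consistent {n} {m} N a =
  ((i : Fin m) → a (int i) ≡ gate N i (a ∘ inp) (λ j _ → a (int j)))
  × (a out ≡ outGate N (a ∘ inp) (a ∘ int))

data Literal (V : Set) : Set where
  pos : V → Literal V
  neg : V → Literal V

Clause : Set → Set
Clause V = List (Literal V)

CNF : Set → Set
CNF V = List (Clause V)

evalLit : ∀ {V} → (V → Bool) → Literal V → Bool
evalLit a (pos v) = a v
evalLit a (neg v) = not (a v)

evalClause : ∀ {V} → (V → Bool) → Clause V → Bool
evalClause a []       = false
evalClause a (l ∷ c)  = evalLit a l ∨ evalClause a c

evalCNF : ∀ {V} → (V → Bool) → CNF V → Bool
evalCNF a []      = true
evalCNF a (c ∷ F) = evalClause a c ∧ evalCNF a F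

Sat : ∀ {V} → CNF V → (V → Bool) → Set
Sat F a = evalCNF a F ≡ true

Specifies : ∀ {n m} → CNF (Var n m) → Circuit n m → Set
Specifies F N = ∀ a → (Sat F a → Consistent N a) × (Consistent N a → Sat F a)

EQ : ∀ {n m' m''} → Assignment n m' → Assignment n m'' → Set
EQ a' a'' = ∀ i → a' (inp i) ≡ a'' (inp i)

Grlx : ∀ {n m' m''} → CNF (Var n m') → CNF (Var n m'') →
       Assignment n m' → Assignment n m'' → Set
Grlx F' F'' a' a'' = Sat F' a' × Sat F'' a''

G : ∀ {n m' m''} → CNF (Var n m') → CNF (Var n m'') →
    Assignment n m' → Assignment n m'' → Set
G F' F'' a' a'' = EQ a' a'' × Grlx F' F'' a' a''

_⟺_ : Set → Set → Set
P ⟺ Q = (P → Q) × (Q → P)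
infix 3 _⟺_

-- ∃W[EQ ∧ G^rlx] ≡ H ∧ ∃W[G^rlx], as formulas in the free variables z', z''
-- (W = X' ∪ X'' ∪ Y' ∪ Y''); H is a formula over z', z'' only, i.e.
-- a Boolean function of (z', z'').
QuantHyp : ∀ {n m' m''} → CNF (Var n m') → CNF (Var n m'') →
           (Bool → Bool → Bool) → Set
QuantHyp F' F'' H = ∀ (b' b'' : Bool) →
  (∃[ a' ] ∃[ a'' ] (a' out ≡ b' × a'' out ≡ b'' × EQ a' a'' × Grlx F' F'' a' a''))
  ⟺
  (H b' b'' ≡ true × ∃[ a' ] ∃[ a'' ] (a' out ≡ b' × a'' out ≡ b'' × Grlx F' F'' a' a''))

module Submission where

open import Defs
open import Data.Bool using (Bool; true)
open import Data.Product using (_×_; ∃-syntax; _,_; proj₁; proj₂)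
open import Relation.Binary.PropositionalEquality using (_≡_; _≢_; refl; sym; trans)

-- The hypothesis on H says that, projected onto the outputs (z', z''),
-- the solutions of EQ ∧ G^rlx are exactly the solutions of G^rlx that
-- satisfy H. Disequality of the outputs is a property of that projection
-- alone, so it survives replacing EQ by H in either direction.

module OutputProjection {n m' m''} (F' : CNF (Var n m')) (F'' : CNF (Var n m''))
         (H : Bool → Bool → Bool) (quant : QuantHyp F' F'' H) where

  G⇒H : ∀ a' a'' → G F' F'' a' a'' → H (a' out) (a'' out) ≡ true
  G⇒H a' a'' (eq , grlx) =
    proj₁ (proj₁ (quant (a' out) (a'' out)) (a' , a'' , refl , refl , eq , grlx))

  H∧Grlx⇒G-sameOutputs : ∀ a' a'' →
    H (a' out) (a'' out) ≡ true → Grlx F' F'' a' a'' →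
    ∃[ b' ] ∃[ b'' ] (b' out ≡ a' out × b'' out ≡ a'' out × G F' F'' b' b'')
  H∧Grlx⇒G-sameOutputs a' a'' h grlx
    with proj₂ (quant (a' out) (a'' out)) (h , a' , a'' , refl , refl , grlx)
  ... | b' , b'' , out' , out'' , eq , grlx-b = b' , b'' , out' , out'' , (eq , grlx-b)

proposition1 : ∀ {n m' m''} (N' : Circuit n m') (N'' : Circuit n m'')
    (F' : CNF (Var n m')) (F'' : CNF (Var n m''))
    → Specifies F' N' → Specifies F'' N''
    → (H : Bool → Bool → Bool)
    → QuantHyp F' F'' H
    → (∃[ a' ] ∃[ a'' ] (G F' F'' a' a'' × a' out ≢ a'' out))
    ⟺
    (∃[ a' ] ∃[ a'' ] (H (a' out) (a'' out) ≡ true × Grlx F' F'' a' a'' × a' out ≢ a'' out))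
proposition1 _ _ F' F'' _ _ H quant = G-sat⇒relaxed-sat , relaxed-sat⇒G-sat
  where
  open OutputProjection F' F'' H quant

  G-sat⇒relaxed-sat :
    ∃[ a' ] ∃[ a'' ] (G F' F'' a' a'' × a' out ≢ a'' out) →
    ∃[ a' ] ∃[ a'' ] (H (a' out) (a'' out) ≡ true × Grlx F' F'' a' a'' × a' out ≢ a'' out)
  G-sat⇒relaxed-sat (a' , a'' , g@(_ , grlx) , differ) =
    a' , a'' , G⇒H a' a'' g , grlx , differ

  relaxed-sat⇒G-sat :
    ∃[ a' ] ∃[ a'' ] (H (a' out) (a'' out) ≡ true × Grlx F' F'' a' a'' × a' out ≢ a'' out) →
    ∃[ a' ] ∃[ a'' ] (G F' F'' a' a'' × a' out ≢ a'' out)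
  relaxed-sat⇒G-sat (a' , a'' , h , grlx , differ)
    with H∧Grlx⇒G-sameOutputs a' a'' h grlx
  ... | b' , b'' , out' , out'' , g =
    b' , b'' , g , λ same → differ (trans (sym out') (trans same out''))
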